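{- Fix an integer $l \geq 1$, let $\mu = 1 + \nu_2(l)$, and for each integer $k \geq 0$ let $C_{k,l} = \{\, l + k\cdot 2^{\mu} + j : 0 \leq j \leq 2^{\mu}-1 \,\}$. Then: (1) for each $k \geq 0$, the value $\nu_2(A_{l,m})$ is the same for all $m \in C_{k,l}$; denote this common value by $\nu_2(C_{k,l})$; (2) for each $k \geq 0$, $\nu_2(C_{k+1,l}) \neq \nu_2(C_{k,l})$.
   Context: For integers $m \geq 1$ and $0 \leq l \leq m$, $A_{l,m} = \frac{l!\, m!}{2^{m-l}} \sum_{k=l}^{m} 2^{k} \binom{2m-2k}{m-k}\binom{m+k}{m}\binom{k}{l}$ (nonzero integers). $\nu_2$ denotes the $2$-adic valuation. -}

module Defs where

open import Data.Nat using (ℕ; zero; suc; _+_; _*_; _∸_; _^_; _≤_; NonZero; _!)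
open import Data.Nat.DivMod using (_/_; _%_)
open import Data.Nat.Combinatorics using (_C_)
open import Data.Nat.Properties using (_≟_; m^n≢0)
open import Relation.Nullary using (yes; no)

sumRange : ℕ → ℕ → (ℕ → ℕ) → ℕ
sumRange a zero    f = 0
sumRange a (suc n) f = f a + sumRange (suc a) n f

innerSum : ℕ → ℕ → ℕ
innerSum l m = sumRange l (suc (m ∸ l))
  (λ k → 2 ^ k * ((2 * m ∸ 2 * k) C (m ∸ k)) * ((m + k) C m) * (k C l))

pow2-nonZero : ∀ n → NonZero (2 ^ n)
pow2-nonZero n = m^n≢0 2 n

-- A_{l,m} = l! m! / 2^{m-l} * innerSum (an integer for 0 ≤ l ≤ m; division is exact)
A : ℕ → ℕ → ℕ
A l m = _/_ (l ! * m ! * innerSum l m) (2 ^ (m ∸ l)) {{pow2-nonZero (m ∸ l)}}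

-- 2-adic valuation of a natural number (ν₂ 0 = 0 by convention; only applied to nonzero values)
ν₂-fuel : ℕ → ℕ → ℕ
ν₂-fuel zero    n = 0
ν₂-fuel (suc f) zero = 0
ν₂-fuel (suc f) n@(suc _) with n % 2 ≟ 0
... | yes _ = suc (ν₂-fuel f (n / 2))
... | no  _ = 0

ν₂ : ℕ → ℕ
ν₂ n = ν₂-fuel n n

{-# OPTIONS --safe #-}
-- Clearing factorials in the sum defining A gives
--   A l (l + n) = 2^l · (n+1)(n+2)⋯(n+2l) · B,   B = Σᵢ C(n,i) · (n+2l+1)⋯(n+2l+i) · (2(n−i)−1)!!,
-- and B is odd because all of its terms except i = 0 are even. Hence
-- ν₂(A l (l + n)) = l + ν₂((n+1)⋯(n+2l)), which changes by ν₂(n+1+2l) − ν₂(n+1) when n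
-- increases by one. Write 2l = 2^μ o with o odd. The two valuations agree unless 2^μ divides n+1;
-- for n+1 = (k+1)2^μ they are μ + ν₂(k+1) and μ + ν₂(k+1+o), which differ since k+1 and k+1+o
-- have opposite parity.
module Submission where

open import Defs
open import Data.Nat
open import Data.Nat.Properties
open import Data.Nat.DivMod
open import Data.Nat.Combinatorics using (_C_; nCk≡n!/k![n-k]!; k![n∸k]!∣n!; nC1≡n)
open import Data.Nat.Divisibility
open import Data.List using (_∷_; [])
open import Data.Product using (∃-syntax; _×_; _,_)
open import Algebra.Properties.CommutativeSemigroup *-commutativeSemigroup using (xy∙z≈xz∙y)
open import Function using (_∘_)
open import Data.Sum using (_⊎_; inj₁; inj₂)
open import Relation.Nullary using (yes; no; ¬_; contradiction)
open import Relation.Binary.PropositionalEquality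
open import Data.Nat.Tactic.RingSolver using (solve)

Odd : ℕ → Set
Odd n = ∃[ t ] n ≡ suc (2 * t)

∣⊎Odd : ∀ n → 2 ∣ n ⊎ Odd n
∣⊎Odd zero = inj₁ (divides-refl 0)
∣⊎Odd (suc n) with ∣⊎Odd n
... | inj₁ (divides-refl q) = inj₂ (q , cong suc (*-comm q 2))
... | inj₂ (t , refl) = inj₁ (divides (suc t) (solve (t ∷ [])))

Odd⇒∤ : ∀ {n} → Odd n → ¬ 2 ∣ n
Odd⇒∤ {n} (t , refl) 2∣n = contradiction (trans (sym odd%2) (n∣m⇒m%n≡0 n 2 2∣n)) λ ()
  where
  odd%2 : suc (2 * t) % 2 ≡ 1
  odd%2 = trans (cong (_% 2) shape) ([m+kn]%n≡m%n 1 t 2)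
    where
    shape : suc (2 * t) ≡ 1 + t * 2
    shape = solve (t ∷ [])

Odd⇒NonZero : ∀ {n} → Odd n → NonZero n
Odd⇒NonZero (t , refl) = _

Odd-* : ∀ {m n} → Odd m → Odd n → Odd (m * n)
Odd-* (s , refl) (t , refl) = 2 * s * t + s + t , solve (s ∷ t ∷ [])

Odd-+-∣ : ∀ {m n} → Odd m → 2 ∣ n → Odd (m + n)
Odd-+-∣ (s , refl) (divides-refl q) = s + q , solve (s ∷ q ∷ [])

Odd-+-Odd : ∀ {m n} → Odd m → Odd n → 2 ∣ m + n
Odd-+-Odd (s , refl) (t , refl) = divides (suc (s + t)) (solve (s ∷ t ∷ []))

Odd[m+n]⇒2∣m*n : ∀ m n → Odd (m + n) → 2 ∣ m * n
Odd[m+n]⇒2∣m*n m n odd with ∣⊎Odd m | ∣⊎Odd n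
... | inj₁ 2∣m | _        = ∣m⇒∣m*n n 2∣m
... | inj₂ _   | inj₁ 2∣n = ∣n⇒∣m*n m 2∣n
... | inj₂ om  | inj₂ on  = contradiction (Odd-+-Odd om on) (Odd⇒∤ odd)

-- Stated for any sufficient fuel so that the recursion of ν₂-fuel can be followed.
ν₂-fuel-decomposition : ∀ f n → n ≤ f → .{{NonZero n}} → ∃[ o ] Odd o × n ≡ 2 ^ ν₂-fuel f n * o
ν₂-fuel-decomposition (suc f) (suc n) (s≤s n≤f) with suc n % 2 ≟ 0
... | yes even = double {ν₂-fuel f half} (ν₂-fuel-decomposition f half half≤f {{half≢0}})
  where
  open ≡-Reasoning
  half = suc n / 2
  n≡half*2 : suc n ≡ half * 2
  n≡half*2 = trans (m≡m%n+[m/n]*n (suc n) 2) (cong (_+ half * 2) even)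
  half≢0 : NonZero half
  half≢0 = ≢-nonZero λ h≡0 → 1+n≢0 (trans n≡half*2 (cong (_* 2) h≡0))
  half≤f : half ≤ f
  half≤f = <⇒≤pred (≤-trans (m/n<m (suc n) 2 (s≤s (s≤s z≤n))) (s≤s n≤f))
  double : ∀ {e} → ∃[ o ] Odd o × half ≡ 2 ^ e * o → ∃[ o ] Odd o × suc n ≡ 2 ^ suc e * o
  double {e} (o , odd , half≡) = o , odd , (begin
    suc n             ≡⟨ n≡half*2 ⟩
    half * 2          ≡⟨ *-comm half 2 ⟩
    2 * half          ≡⟨ cong (2 *_) half≡ ⟩
    2 * (2 ^ e * o)   ≡⟨ *-assoc 2 (2 ^ e) o ⟨
    2 ^ suc e * o     ∎)
... | no odd = suc n , (suc n / 2 , n≡1+half*2) , sym (*-identityˡ (suc n))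
  where
  n%2≡1 : suc n % 2 ≡ 1
  n%2≡1 with suc n % 2 | m%n<n (suc n) 2
  ... | 0 | _ = contradiction refl odd
  ... | 1 | _ = refl
  ... | 2+ _ | s≤s (s≤s ())
  n≡1+half*2 : suc n ≡ suc (2 * (suc n / 2))
  n≡1+half*2 = trans (m≡m%n+[m/n]*n (suc n) 2) (cong₂ _+_ n%2≡1 (*-comm (suc n / 2) 2))

2^*Odd-injective : ∀ {a b m n} → Odd m → Odd n → 2 ^ a * m ≡ 2 ^ b * n → a ≡ b
2^*Odd-injective {zero}  {zero}  _  _  _  = refl
2^*Odd-injective {zero}  {suc b} {m} {n} om _ eq =
  contradiction (subst (2 ∣_) (trans (sym eq) (*-identityˡ m)) (∣m⇒∣m*n n (m∣m*n (2 ^ b)))) (Odd⇒∤ om)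
2^*Odd-injective {suc a} {zero}  om on eq = sym (2^*Odd-injective on om (sym eq))
2^*Odd-injective {suc a} {suc b} {m} {n} om on eq =
  cong suc (2^*Odd-injective om on (*-cancelˡ-≡ (2 ^ a * m) (2 ^ b * n) 2
    (trans (sym (*-assoc 2 (2 ^ a) m)) (trans eq (*-assoc 2 (2 ^ b) n)))))

ν₂-decomposition : ∀ n .{{_ : NonZero n}} → ∃[ o ] Odd o × n ≡ 2 ^ ν₂ n * o
ν₂-decomposition n = ν₂-fuel-decomposition n n ≤-refl

ν₂-2^*Odd : ∀ v {o} → Odd o → ν₂ (2 ^ v * o) ≡ v
ν₂-2^*Odd v {o} odd with o′ , odd′ , eq ← ν₂-decomposition (2 ^ v * o) {{m*n≢0 _ _ {{m^n≢0 2 v}} {{Odd⇒NonZero odd}}}}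
  = 2^*Odd-injective odd′ odd (sym eq)

ν₂-Odd : ∀ {n} → Odd n → ν₂ n ≡ 0
ν₂-Odd {n} odd = subst (λ x → ν₂ x ≡ 0) (*-identityˡ n) (ν₂-2^*Odd 0 odd)

ν₂-2^ : ∀ v → ν₂ (2 ^ v) ≡ v
ν₂-2^ v = subst (λ x → ν₂ x ≡ v) (*-identityʳ (2 ^ v)) (ν₂-2^*Odd v (0 , refl))

ν₂-* : ∀ m n .{{_ : NonZero m}} .{{_ : NonZero n}} → ν₂ (m * n) ≡ ν₂ m + ν₂ n
ν₂-* m n with o , odd , m≡ ← ν₂-decomposition m | o′ , odd′ , n≡ ← ν₂-decomposition n =
  trans (cong ν₂ m*n≡) (ν₂-2^*Odd (ν₂ m + ν₂ n) (Odd-* odd odd′))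
  where
  m*n≡ : m * n ≡ 2 ^ (ν₂ m + ν₂ n) * (o * o′)
  m*n≡ = begin
    m * n                               ≡⟨ cong₂ _*_ m≡ n≡ ⟩
    2 ^ ν₂ m * o * (2 ^ ν₂ n * o′)      ≡⟨ interchange (2 ^ ν₂ m) o (2 ^ ν₂ n) o′ ⟩
    2 ^ ν₂ m * 2 ^ ν₂ n * (o * o′)      ≡⟨ cong (_* (o * o′)) (^-distribˡ-+-* 2 (ν₂ m) (ν₂ n)) ⟨
    2 ^ (ν₂ m + ν₂ n) * (o * o′)        ∎
    where
    open ≡-Reasoning
    interchange : ∀ a b c d → a * b * (c * d) ≡ a * c * (b * d)
    interchange a b c d = solve (a ∷ b ∷ c ∷ d ∷ [])

2^ν₂∣ : ∀ n .{{_ : NonZero n}} → 2 ^ ν₂ n ∣ n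
2^ν₂∣ n with o , _ , n≡ ← ν₂-decomposition n = divides o (trans n≡ (*-comm (2 ^ ν₂ n) o))

ν₂-*2^ : ∀ m μ .{{_ : NonZero m}} → ν₂ (m * 2 ^ μ) ≡ ν₂ m + μ
ν₂-*2^ m μ = trans (ν₂-* m (2 ^ μ)) (cong (ν₂ m +_) (ν₂-2^ μ))
  where instance _ = m^n≢0 2 μ

ν₂-+-< : ∀ m n .{{_ : NonZero m}} → ν₂ m < ν₂ n → ν₂ (m + n) ≡ ν₂ m
ν₂-+-< m (suc n) ν₂m<ν₂n
  with o , odd , m≡ ← ν₂-decomposition m | o′ , odd′ , n≡ ← ν₂-decomposition (suc n) =
  trans (cong ν₂ m+n≡) (ν₂-2^*Odd (ν₂ m) (Odd-+-∣ odd (m∣m*n (2 ^ d * o′))))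
  where
  a = ν₂ m
  d = ν₂ (suc n) ∸ suc a
  m+n≡ : m + suc n ≡ 2 ^ a * (o + 2 * (2 ^ d * o′))
  m+n≡ = begin
    m + suc n                                ≡⟨ cong₂ _+_ m≡ n≡ ⟩
    2 ^ a * o + 2 ^ ν₂ (suc n) * o′          ≡⟨ cong (λ e → 2 ^ a * o + 2 ^ e * o′) (m+[n∸m]≡n ν₂m<ν₂n) ⟨
    2 ^ a * o + 2 ^ (suc a + d) * o′         ≡⟨ cong (λ p → 2 ^ a * o + p * o′) (^-distribˡ-+-* 2 (suc a) d) ⟩
    2 ^ a * o + 2 * 2 ^ a * 2 ^ d * o′       ≡⟨ factor (2 ^ a) o (2 ^ d) o′ ⟩
    2 ^ a * (o + 2 * (2 ^ d * o′))           ∎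
    where
    open ≡-Reasoning
    factor : ∀ p o q o′ → p * o + 2 * p * q * o′ ≡ p * (o + 2 * (q * o′))
    factor p o q o′ = solve (p ∷ o ∷ q ∷ o′ ∷ [])

ν₂-+-<′ : ∀ m n .{{_ : NonZero n}} → ν₂ n < ν₂ m → ν₂ (m + n) ≡ ν₂ n
ν₂-+-<′ m n ν₂n<ν₂m = trans (cong ν₂ (+-comm m n)) (ν₂-+-< n m ν₂n<ν₂m)

∣⇒ν₂>0 : ∀ n .{{_ : NonZero n}} → 2 ∣ n → 0 < ν₂ n
∣⇒ν₂>0 .(q * 2) (divides-refl q) =
  subst (0 <_) (sym (trans (ν₂-* q 2 {{m*n≢0⇒m≢0 q}}) (+-comm (ν₂ q) 1))) z<s

2^ν₂≤ : ∀ n .{{_ : NonZero n}} → 2 ^ ν₂ n ≤ n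
2^ν₂≤ n with o , odd , n≡ ← ν₂-decomposition n =
  subst (2 ^ ν₂ n ≤_) (sym n≡) (m≤m*n (2 ^ ν₂ n) o {{Odd⇒NonZero odd}})

<2^⇒ν₂< : ∀ n μ .{{_ : NonZero n}} → n < 2 ^ μ → ν₂ n < μ
<2^⇒ν₂< n μ n<2^μ with ν₂ n <? μ
... | yes v<μ = v<μ
... | no  v≮μ = contradiction (≤-trans (^-monoʳ-≤ 2 (≮⇒≥ v≮μ)) (2^ν₂≤ n)) (<⇒≱ n<2^μ)

ν₂-*2^+ : ∀ a μ r .{{_ : NonZero r}} → r < 2 ^ μ → ν₂ (a * 2 ^ μ + r) ≡ ν₂ r
ν₂-*2^+ zero    μ r r<2^μ = refl
ν₂-*2^+ a@(suc _) μ r r<2^μ = ν₂-+-<′ (a * 2 ^ μ) r (<-≤-trans (<2^⇒ν₂< r μ r<2^μ) μ≤)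
  where
  μ≤ : μ ≤ ν₂ (a * 2 ^ μ)
  μ≤ = subst (μ ≤_) (sym (ν₂-*2^ a μ)) (m≤n+m μ (ν₂ a))

ν₂-+Odd-≢ : ∀ m {o} .{{_ : NonZero m}} → Odd o → ν₂ m ≢ ν₂ (m + o)
ν₂-+Odd-≢ m {o} odd with ∣⊎Odd m
... | inj₁ 2∣m = λ eq → >⇒≢ ν₂m>0 (trans eq ν₂[m+o]≡0)
  where
  instance _ = Odd⇒NonZero odd
  ν₂m>0 = ∣⇒ν₂>0 m 2∣m
  ν₂[m+o]≡0 : ν₂ (m + o) ≡ 0
  ν₂[m+o]≡0 = trans (ν₂-+-<′ m o (subst (_< ν₂ m) (sym (ν₂-Odd odd)) ν₂m>0)) (ν₂-Odd odd)
... | inj₂ oddm = λ eq → <⇒≢ ν₂[m+o]>0 (trans (sym (ν₂-Odd oddm)) eq)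
  where
  instance _ = >-nonZero (<-≤-trans (>-nonZero⁻¹ m) (m≤m+n m o))
  ν₂[m+o]>0 = ∣⇒ν₂>0 (m + o) (Odd-+-Odd oddm odd)

rising : ℕ → ℕ → ℕ
rising a zero    = 1
rising a (suc t) = rising a t * (a + suc t)

rising-nonZero : ∀ a t → NonZero (rising a t)
rising-nonZero a zero    = _
rising-nonZero a (suc t) = m*n≢0 _ _ {{rising-nonZero a t}} {{>-nonZero (<-≤-trans z<s (m≤n+m (suc t) a))}}

rising-suc : ∀ a t → rising (suc a) t * suc a ≡ rising a t * (suc a + t)
rising-suc a zero = cong suc (sym (+-identityʳ (a + 0)))
rising-suc a (suc t) = begin
  rising (suc a) t * (suc a + suc t) * suc a   ≡⟨ xy∙z≈xz∙y (rising (suc a) t) _ (suc a) ⟩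
  rising (suc a) t * suc a * (suc a + suc t)   ≡⟨ cong (_* (suc a + suc t)) (rising-suc a t) ⟩
  rising a t * (suc a + t) * (suc a + suc t)   ≡⟨ cong (λ x → rising a t * x * (suc a + suc t)) (sym (+-suc a t)) ⟩
  rising a t * (a + suc t) * (suc a + suc t)   ∎
  where open ≡-Reasoning

2∣rising : ∀ a t → 2 ≤ t → 2 ∣ rising a t
2∣rising a 1 (s≤s ())
2∣rising a (suc (suc s)) _ = subst (2 ∣_) (sym (*-assoc (rising a s) _ _))
  (∣n⇒∣m*n (rising a s) (Odd[m+n]⇒2∣m*n (a + suc s) (a + suc (suc s)) (a + suc s , shape a s)))
  where
  shape : ∀ a s → a + suc s + (a + suc (suc s)) ≡ suc (2 * (a + suc s))
  shape a s = solve (a ∷ s ∷ [])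

ν₂-rising-suc : ∀ a n → ν₂ (rising (suc n) a) + ν₂ (suc n) ≡ ν₂ (rising n a) + ν₂ (suc n + a)
ν₂-rising-suc a n = begin
  ν₂ (rising (suc n) a) + ν₂ (suc n)     ≡⟨ ν₂-* (rising (suc n) a) (suc n) ⟨
  ν₂ (rising (suc n) a * suc n)          ≡⟨ cong ν₂ (rising-suc n a) ⟩
  ν₂ (rising n a * (suc n + a))          ≡⟨ ν₂-* (rising n a) (suc n + a) ⟩
  ν₂ (rising n a) + ν₂ (suc n + a)       ∎
  where
  open ≡-Reasoning
  instance
    _ = rising-nonZero n a
    _ = rising-nonZero (suc n) a

ν₂-rising-block : ∀ a μ → 2 ^ μ ∣ a → ∀ k j → j < 2 ^ μ →
                  ν₂ (rising (k * 2 ^ μ + j) a) ≡ ν₂ (rising (k * 2 ^ μ) a)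
ν₂-rising-block a μ 2^μ∣a k zero    _     = cong (λ n → ν₂ (rising n a)) (+-identityʳ (k * 2 ^ μ))
ν₂-rising-block a μ (divides-refl q) k (suc j) 1+j<2^μ =
  trans (+-cancelʳ-≡ (ν₂ (suc j)) _ _ step) (ν₂-rising-block a μ (divides-refl q) k j (<-trans (n<1+n j) 1+j<2^μ))
  where
  n = k * 2 ^ μ + j
  1+n≡ : suc n ≡ k * 2 ^ μ + suc j
  1+n≡ = sym (+-suc (k * 2 ^ μ) j)
  ν₂[1+n] : ν₂ (suc n) ≡ ν₂ (suc j)
  ν₂[1+n] = trans (cong ν₂ 1+n≡) (ν₂-*2^+ k μ (suc j) 1+j<2^μ)
  ν₂[1+n+a] : ν₂ (suc n + a) ≡ ν₂ (suc j)
  ν₂[1+n+a] = trans (cong ν₂ shape) (ν₂-*2^+ (k + q) μ (suc j) 1+j<2^μ)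
    where
    shape : suc n + q * 2 ^ μ ≡ (k + q) * 2 ^ μ + suc j
    shape = lemma k q (2 ^ μ) j
      where
      lemma : ∀ k q p j → suc (k * p + j + q * p) ≡ (k + q) * p + suc j
      lemma k q p j = solve (k ∷ q ∷ p ∷ j ∷ [])
  step : ν₂ (rising (k * 2 ^ μ + suc j) a) + ν₂ (suc j) ≡ ν₂ (rising n a) + ν₂ (suc j)
  step = begin
    ν₂ (rising (k * 2 ^ μ + suc j) a) + ν₂ (suc j)   ≡⟨ cong₂ (λ m v → ν₂ (rising m a) + v) 1+n≡ ν₂[1+n] ⟨
    ν₂ (rising (suc n) a) + ν₂ (suc n)                ≡⟨ ν₂-rising-suc a n ⟩
    ν₂ (rising n a) + ν₂ (suc n + a)                  ≡⟨ cong (ν₂ (rising n a) +_) ν₂[1+n+a] ⟩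
    ν₂ (rising n a) + ν₂ (suc j)                      ∎
    where open ≡-Reasoning

ν₂-rising-jump : ∀ a .{{_ : NonZero a}} k →
                 ν₂ (rising (suc k * 2 ^ ν₂ a) a) ≢ ν₂ (rising (k * 2 ^ ν₂ a) a)
ν₂-rising-jump a k eq with o , odd , a≡ ← ν₂-decomposition a =
  ν₂-+Odd-≢ (suc k) odd (+-cancelʳ-≡ μ _ _ (begin
    ν₂ (suc k) + μ                  ≡⟨ ν₂-*2^ (suc k) μ ⟨
    ν₂ (suc k * p)                  ≡⟨ cong ν₂ 1+n≡ ⟨
    ν₂ (suc n)                      ≡⟨ +-cancelˡ-≡ (ν₂ (rising n a)) _ _ step ⟩
    ν₂ (suc n + a)                  ≡⟨ cong ν₂ 1+n+a≡ ⟩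
    ν₂ ((suc k + o) * p)            ≡⟨ ν₂-*2^ (suc k + o) μ ⟩
    ν₂ (suc k + o) + μ              ∎))
  where
  open ≡-Reasoning
  μ = ν₂ a
  p = 2 ^ μ
  instance _ = m^n≢0 2 μ
  n = k * p + pred p
  1+n≡ : suc n ≡ suc k * p
  1+n≡ = begin
    suc (k * p + pred p)   ≡⟨ +-suc (k * p) (pred p) ⟨
    k * p + suc (pred p)   ≡⟨ cong (k * p +_) (suc-pred p) ⟩
    k * p + p              ≡⟨ +-comm (k * p) p ⟩
    suc k * p              ∎
  1+n+a≡ : suc n + a ≡ (suc k + o) * p
  1+n+a≡ = begin
    suc n + a              ≡⟨ cong₂ _+_ 1+n≡ (trans a≡ (*-comm p o)) ⟩
    suc k * p + o * p      ≡⟨ *-distribʳ-+ p (suc k) o ⟨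
    (suc k + o) * p        ∎
  ν₂[rising-n]≡ : ν₂ (rising n a) ≡ ν₂ (rising (k * p) a)
  ν₂[rising-n]≡ = ν₂-rising-block a μ (2^ν₂∣ a) k (pred p) (subst (pred p <_) (suc-pred p) ≤-refl)
  step : ν₂ (rising n a) + ν₂ (suc n) ≡ ν₂ (rising n a) + ν₂ (suc n + a)
  step = begin
    ν₂ (rising n a) + ν₂ (suc n)          ≡⟨ cong (_+ ν₂ (suc n)) (trans ν₂[rising-n]≡ (sym eq)) ⟩
    ν₂ (rising (suc k * p) a) + ν₂ (suc n) ≡⟨ cong (λ m → ν₂ (rising m a) + ν₂ (suc n)) 1+n≡ ⟨
    ν₂ (rising (suc n) a) + ν₂ (suc n)     ≡⟨ ν₂-rising-suc a n ⟩
    ν₂ (rising n a) + ν₂ (suc n + a)       ∎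

!-rising : ∀ a t → (a + t) ! ≡ a ! * rising a t
!-rising a zero    = trans (cong _! (+-identityʳ a)) (sym (*-identityʳ (a !)))
!-rising a (suc t) = begin
  (a + suc t) !                      ≡⟨ cong _! (+-suc a t) ⟩
  suc (a + t) * (a + t) !            ≡⟨ cong (suc (a + t) *_) (!-rising a t) ⟩
  suc (a + t) * (a ! * rising a t)   ≡⟨ rearrange (suc (a + t)) (a !) (rising a t) ⟩
  a ! * (rising a t * suc (a + t))   ≡⟨ cong (λ x → a ! * (rising a t * x)) (+-suc a t) ⟨
  a ! * rising a (suc t)             ∎
  where
  open ≡-Reasoning
  rearrange : ∀ x y z → x * (y * z) ≡ y * (z * x)
  rearrange x y z = solve (x ∷ y ∷ z ∷ [])

C-! : ∀ k r → ((k + r) C k) * (k ! * r !) ≡ (k + r) !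
C-! k r = begin
  ((k + r) C k) * (k ! * r !)               ≡⟨ cong (λ x → ((k + r) C k) * (k ! * x !)) (m+n∸m≡n k r) ⟨
  ((k + r) C k) * (k ! * (k + r ∸ k) !)     ≡⟨ cong (_* (k ! * (k + r ∸ k) !)) (nCk≡n!/k![n-k]! k≤k+r) ⟩
  (k + r) ! / (k ! * (k + r ∸ k) !) * (k ! * (k + r ∸ k) !)
                                            ≡⟨ m/n*n≡m (k![n∸k]!∣n! k≤k+r) ⟩
  (k + r) !                               ∎
  where
  open ≡-Reasoning
  k≤k+r = m≤m+n k r
  instance _ = k !* (k + r ∸ k) !≢0

oddFactorial : ℕ → ℕ
oddFactorial zero    = 1
oddFactorial (suc j) = suc (2 * j) * oddFactorial j

Odd-oddFactorial : ∀ j → Odd (oddFactorial j)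
Odd-oddFactorial zero    = 0 , refl
Odd-oddFactorial (suc j) = Odd-* (j , refl) (Odd-oddFactorial j)

!-double : ∀ j → (2 * j) ! ≡ 2 ^ j * j ! * oddFactorial j
!-double zero    = refl
!-double (suc j) = begin
  (2 * suc j) !                                          ≡⟨ cong _! (*-suc 2 j) ⟩
  suc (suc (2 * j)) * (suc (2 * j) * (2 * j) !)         ≡⟨ cong (λ x → suc (suc (2 * j)) * (suc (2 * j) * x)) (!-double j) ⟩
  suc (suc (2 * j)) * (suc (2 * j) * (2 ^ j * j ! * oddFactorial j))
                                                         ≡⟨ rearrange j (2 ^ j) (j !) (oddFactorial j) ⟩
  2 ^ suc j * suc j ! * oddFactorial (suc j)             ∎
  where
  open ≡-Reasoning
  rearrange : ∀ j p f d → suc (suc (2 * j)) * (suc (2 * j) * (p * f * d)) ≡ 2 * p * (suc j * f) * (suc (2 * j) * d)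
  rearrange j p f d = solve (j ∷ p ∷ f ∷ d ∷ [])

central-C : ∀ j → ((2 * j) C j) * j ! ≡ 2 ^ j * oddFactorial j
central-C j = *-cancelʳ-≡ _ _ (j !) {{j !≢0}} (begin
  ((2 * j) C j) * j ! * j !               ≡⟨ *-assoc (((2 * j) C j)) (j !) (j !) ⟩
  ((2 * j) C j) * (j ! * j !)             ≡⟨ cong (λ x → (x C j) * (j ! * j !)) j+j≡2j ⟨
  ((j + j) C j) * (j ! * j !)             ≡⟨ C-! j j ⟩
  (j + j) !                             ≡⟨ cong _! j+j≡2j ⟩
  (2 * j) !                             ≡⟨ !-double j ⟩
  2 ^ j * j ! * oddFactorial j          ≡⟨ xy∙z≈xz∙y (2 ^ j) (j !) (oddFactorial j) ⟩
  2 ^ j * oddFactorial j * j !          ∎)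
  where
  open ≡-Reasoning
  j+j≡2j : j + j ≡ 2 * j
  j+j≡2j = cong (j +_) (sym (+-identityʳ j))

*-distribˡ-sumRange : ∀ c a n f → c * sumRange a n f ≡ sumRange a n (λ k → c * f k)
*-distribˡ-sumRange c a zero    f = *-zeroʳ c
*-distribˡ-sumRange c a (suc n) f =
  trans (*-distribˡ-+ c (f a) _) (cong (c * f a +_) (*-distribˡ-sumRange c (suc a) n f))

sumRange-shift : ∀ a b n f → sumRange (a + b) n f ≡ sumRange b n (λ i → f (a + i))
sumRange-shift a b zero    f = refl
sumRange-shift a b (suc n) f =
  cong (f (a + b) +_) (trans (cong (λ c → sumRange c n f) (sym (+-suc a b))) (sumRange-shift a (suc b) n f))

sumRange-cong : ∀ a n {f g} → (∀ i → a ≤ i → i < a + n → f i ≡ g i) → sumRange a n f ≡ sumRange a n g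
sumRange-cong a zero    f≡g = refl
sumRange-cong a (suc n) f≡g = cong₂ _+_ (f≡g a ≤-refl (m<m+n a z<s))
  (sumRange-cong (suc a) n λ i a<i i<a+1+n → f≡g i (<⇒≤ a<i) (subst (i <_) (sym (+-suc a n)) i<a+1+n))

2∣sumRange : ∀ a n {f} → (∀ i → a ≤ i → 2 ∣ f i) → 2 ∣ sumRange a n f
2∣sumRange a zero    2∣f = divides-refl 0
2∣sumRange a (suc n) 2∣f = ∣m∣n⇒∣m+n (2∣f a ≤-refl) (2∣sumRange (suc a) n λ i a<i → 2∣f i (<⇒≤ a<i))

innerTerm : ℕ → ℕ → ℕ → ℕ
innerTerm l m k = 2 ^ k * ((2 * m ∸ 2 * k) C (m ∸ k)) * ((m + k) C m) * (k C l)

oddPartTerm : ℕ → ℕ → ℕ → ℕ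
oddPartTerm l n i = (n C i) * rising (n + 2 * l) i * oddFactorial (n ∸ i)

!-split : ∀ l i j → (l + (i + j) + (l + i)) ! ≡ (i + j) ! * rising (i + j) (2 * l) * rising (i + j + 2 * l) i
!-split l i j = begin
  (l + n + (l + i)) !                           ≡⟨ cong _! (shape l n i) ⟩
  (n + 2 * l + i) !                             ≡⟨ !-rising (n + 2 * l) i ⟩
  (n + 2 * l) ! * rising (n + 2 * l) i          ≡⟨ cong (_* rising (n + 2 * l) i) (!-rising n (2 * l)) ⟩
  n ! * rising n (2 * l) * rising (n + 2 * l) i ∎
  where
  open ≡-Reasoning
  n = i + j
  shape : ∀ l n i → l + n + (l + i) ≡ n + 2 * l + i
  shape l n i = solve (l ∷ n ∷ i ∷ [])

innerTerm-cleared : ∀ l i j → let m = l + (i + j); k = l + i in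
  l ! * m ! * innerTerm l m k * (i ! * j !) ≡ 2 ^ m * oddFactorial j * (m + k) !
innerTerm-cleared l i j = begin
  l ! * m ! * innerTerm l m k * (i ! * j !)
    ≡⟨ cong₂ (λ x y → l ! * m ! * (2 ^ k * (x C y) * ((m + k) C m) * (k C l)) * (i ! * j !)) 2m∸2k≡2j m∸k≡j ⟩
  l ! * m ! * (2 ^ k * ((2 * j) C j) * ((m + k) C m) * (k C l)) * (i ! * j !)
    ≡⟨ regroup (l !) (m !) (2 ^ k) ((2 * j) C j) ((m + k) C m) (k C l) (i !) (j !) ⟩
  2 ^ k * (((2 * j) C j) * j !) * (((m + k) C m) * (m ! * ((k C l) * (l ! * i !))))
    ≡⟨ cong₂ (λ x y → 2 ^ k * x * (((m + k) C m) * (m ! * y))) (central-C j) (C-! l i) ⟩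
  2 ^ k * (2 ^ j * oddFactorial j) * (((m + k) C m) * (m ! * k !))
    ≡⟨ cong (2 ^ k * (2 ^ j * oddFactorial j) *_) (C-! m k) ⟩
  2 ^ k * (2 ^ j * oddFactorial j) * (m + k) !
    ≡⟨ cong (_* (m + k) !) (*-assoc (2 ^ k) (2 ^ j) (oddFactorial j)) ⟨
  2 ^ k * 2 ^ j * oddFactorial j * (m + k) !
    ≡⟨ cong (λ p → p * oddFactorial j * (m + k) !) 2^m≡ ⟨
  2 ^ m * oddFactorial j * (m + k) ! ∎
  where
  open ≡-Reasoning
  m = l + (i + j)
  k = l + i
  m≡k+j : m ≡ k + j
  m≡k+j = sym (+-assoc l i j)
  m∸k≡j : m ∸ k ≡ j
  m∸k≡j = trans (cong (_∸ k) m≡k+j) (m+n∸m≡n k j)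
  2m∸2k≡2j : 2 * m ∸ 2 * k ≡ 2 * j
  2m∸2k≡2j = trans (cong (λ x → 2 * x ∸ 2 * k) m≡k+j)
                   (trans (cong (_∸ 2 * k) (*-distribˡ-+ 2 k j)) (m+n∸m≡n (2 * k) (2 * j)))
  2^m≡ : 2 ^ m ≡ 2 ^ k * 2 ^ j
  2^m≡ = trans (cong (2 ^_) m≡k+j) (^-distribˡ-+-* 2 k j)
  regroup : ∀ a b p c d e f g → a * b * (p * c * d * e) * (f * g) ≡ p * (c * g) * (d * (b * (e * (a * f))))
  regroup a b p c d e f g = solve (a ∷ b ∷ p ∷ c ∷ d ∷ e ∷ f ∷ g ∷ [])

oddPartTerm-cleared : ∀ l i j → let n = i + j in
  2 ^ (l + n) * rising n (2 * l) * oddPartTerm l n i * (i ! * j !) ≡ 2 ^ (l + n) * oddFactorial j * (l + n + (l + i)) !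
oddPartTerm-cleared l i j = begin
  p * rising n (2 * l) * ((n C i) * rising (n + 2 * l) i * oddFactorial (n ∸ i)) * (i ! * j !)
    ≡⟨ cong (λ x → p * rising n (2 * l) * ((n C i) * rising (n + 2 * l) i * oddFactorial x) * (i ! * j !)) (m+n∸m≡n i j) ⟩
  p * rising n (2 * l) * ((n C i) * rising (n + 2 * l) i * oddFactorial j) * (i ! * j !)
    ≡⟨ regroup p (rising n (2 * l)) (n C i) (rising (n + 2 * l) i) (oddFactorial j) (i ! * j !) ⟩
  p * oddFactorial j * ((n C i) * (i ! * j !) * rising n (2 * l) * rising (n + 2 * l) i)
    ≡⟨ cong (λ x → p * oddFactorial j * (x * rising n (2 * l) * rising (n + 2 * l) i)) (C-! i j) ⟩
  p * oddFactorial j * (n ! * rising n (2 * l) * rising (n + 2 * l) i)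
    ≡⟨ cong (p * oddFactorial j *_) (!-split l i j) ⟨
  p * oddFactorial j * (l + n + (l + i)) ! ∎
  where
  open ≡-Reasoning
  n = i + j
  p = 2 ^ (l + n)
  regroup : ∀ p r c s d f → p * r * (c * s * d) * f ≡ p * d * (c * f * r * s)
  regroup p r c s d f = solve (p ∷ r ∷ c ∷ s ∷ d ∷ f ∷ [])

-- Both sides are compared after multiplying by i! j!, which clears the binomial coefficients.
innerTerm-closed : ∀ l i j → l ! * (l + (i + j)) ! * innerTerm l (l + (i + j)) (l + i)
                             ≡ 2 ^ (l + (i + j)) * rising (i + j) (2 * l) * oddPartTerm l (i + j) i
innerTerm-closed l i j = *-cancelʳ-≡ _ _ (i ! * j !) {{i !* j !≢0}}
  (trans (innerTerm-cleared l i j) (sym (oddPartTerm-cleared l i j)))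

oddPart : ℕ → ℕ → ℕ
oddPart l n = sumRange 0 (suc n) (oddPartTerm l n)

innerSum-closed : ∀ l n → l ! * (l + n) ! * innerSum l (l + n) ≡ 2 ^ (l + n) * rising n (2 * l) * oddPart l n
innerSum-closed l n = begin
  c * innerSum l (l + n)                               ≡⟨ cong (λ x → c * sumRange l (suc x) (innerTerm l (l + n))) (m+n∸m≡n l n) ⟩
  c * sumRange l (suc n) (innerTerm l (l + n))         ≡⟨ *-distribˡ-sumRange c l (suc n) _ ⟩
  sumRange l (suc n) scaled                            ≡⟨ cong (λ a → sumRange a (suc n) scaled) (+-identityʳ l) ⟨
  sumRange (l + 0) (suc n) scaled                      ≡⟨ sumRange-shift l 0 (suc n) scaled ⟩
  sumRange 0 (suc n) (λ i → c * innerTerm l (l + n) (l + i))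
                                                       ≡⟨ sumRange-cong 0 (suc n) termwise ⟩
  sumRange 0 (suc n) (λ i → c′ * oddPartTerm l n i)    ≡⟨ *-distribˡ-sumRange c′ 0 (suc n) _ ⟨
  c′ * oddPart l n                                     ∎
  where
  open ≡-Reasoning
  c = l ! * (l + n) !
  c′ = 2 ^ (l + n) * rising n (2 * l)
  scaled : ℕ → ℕ
  scaled k = c * innerTerm l (l + n) k
  termwise : ∀ i → 0 ≤ i → i < suc n → c * innerTerm l (l + n) (l + i) ≡ c′ * oddPartTerm l n i
  termwise i _ (s≤s i≤n) = subst (λ n′ → l ! * (l + n′) ! * innerTerm l (l + n′) (l + i) ≡ 2 ^ (l + n′) * rising n′ (2 * l) * oddPartTerm l n′ i)
                                 (m+[n∸m]≡n i≤n) (innerTerm-closed l i (n ∸ i))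

A-closed : ∀ l n → A l (l + n) ≡ 2 ^ l * rising n (2 * l) * oddPart l n
A-closed l n = begin
  A l (l + n)                                           ≡⟨ cong (λ e → (l ! * (l + n) ! * innerSum l (l + n) / 2 ^ e) {{pow2-nonZero e}}) (m+n∸m≡n l n) ⟩
  (l ! * (l + n) ! * innerSum l (l + n)) / 2 ^ n        ≡⟨ /-congˡ (trans (innerSum-closed l n) shape) ⟩
  2 ^ l * rising n (2 * l) * oddPart l n * 2 ^ n / 2 ^ n ≡⟨ m*n/n≡m _ (2 ^ n) ⟩
  2 ^ l * rising n (2 * l) * oddPart l n                ∎
  where
  open ≡-Reasoning
  instance _ = m^n≢0 2 n
  shape : 2 ^ (l + n) * rising n (2 * l) * oddPart l n ≡ 2 ^ l * rising n (2 * l) * oddPart l n * 2 ^ n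
  shape = trans (cong (λ p → p * rising n (2 * l) * oddPart l n) (^-distribˡ-+-* 2 l n))
                (rearrange (2 ^ l) (2 ^ n) (rising n (2 * l)) (oddPart l n))
    where
    rearrange : ∀ a b r s → a * b * r * s ≡ a * r * s * b
    rearrange a b r s = solve (a ∷ b ∷ r ∷ s ∷ [])

Odd-oddPart : ∀ l n → Odd (oddPart l n)
Odd-oddPart l n = Odd-+-∣ leading (rest n)
  where
  leading : Odd (oddPartTerm l n 0)
  leading = subst Odd (sym (*-identityˡ (oddFactorial n))) (Odd-oddFactorial n)
  rest : ∀ n → 2 ∣ sumRange 1 n (oddPartTerm l n)
  rest zero    = divides-refl 0
  rest (suc n) = ∣m∣n⇒∣m+n (∣m⇒∣m*n _ linear) (2∣sumRange 2 n λ i 2≤i →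
      ∣m⇒∣m*n (oddFactorial (suc n ∸ i)) (∣n⇒∣m*n (suc n C i) (2∣rising (suc n + 2 * l) i 2≤i)))
    where
    linear : 2 ∣ (suc n C 1) * rising (suc n + 2 * l) 1
    linear = subst (λ x → 2 ∣ x * rising (suc n + 2 * l) 1) (sym (nC1≡n (suc n)))
                   (Odd[m+n]⇒2∣m*n (suc n) _ (suc n + l , shape n l))
      where
      shape : ∀ n l → suc n + 1 * (suc n + 2 * l + 1) ≡ suc (2 * (suc n + l))
      shape n l = solve (n ∷ l ∷ [])

ν₂-A : ∀ l n → ν₂ (A l (l + n)) ≡ l + ν₂ (rising n (2 * l))
ν₂-A l n = begin
  ν₂ (A l (l + n))                            ≡⟨ cong ν₂ (A-closed l n) ⟩
  ν₂ (2 ^ l * r * oddPart l n)                ≡⟨ ν₂-* (2 ^ l * r) (oddPart l n) ⟩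
  ν₂ (2 ^ l * r) + ν₂ (oddPart l n)           ≡⟨ cong₂ _+_ (ν₂-* (2 ^ l) r) (ν₂-Odd (Odd-oddPart l n)) ⟩
  ν₂ (2 ^ l) + ν₂ r + 0                       ≡⟨ cong (_+ 0) (cong (_+ ν₂ r) (ν₂-2^ l)) ⟩
  l + ν₂ r + 0                                ≡⟨ +-identityʳ (l + ν₂ r) ⟩
  l + ν₂ r                                    ∎
  where
  open ≡-Reasoning
  r = rising n (2 * l)
  instance
    _ = m^n≢0 2 l
    _ = rising-nonZero n (2 * l)
    _ = m*n≢0 (2 ^ l) r
    _ = Odd⇒NonZero (Odd-oddPart l n)

lemma3p4 : (l : ℕ) → 1 ≤ l →
    ((k j j′ : ℕ) → j < 2 ^ (1 + ν₂ l) → j′ < 2 ^ (1 + ν₂ l) →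
      ν₂ (A l (l + k * 2 ^ (1 + ν₂ l) + j)) ≡ ν₂ (A l (l + k * 2 ^ (1 + ν₂ l) + j′)))
    × ((k : ℕ) →
      ν₂ (A l (l + suc k * 2 ^ (1 + ν₂ l))) ≢ ν₂ (A l (l + k * 2 ^ (1 + ν₂ l))))
lemma3p4 l 1≤l = constantOnBlocks , changesBetweenBlocks
  where
  instance
    _ = >-nonZero 1≤l
    _ = m*n≢0 2 l
  μ = 1 + ν₂ l
  ν₂[2l]≡μ : ν₂ (2 * l) ≡ μ
  ν₂[2l]≡μ = ν₂-* 2 l
  ν₂-A-block : ∀ k j → j < 2 ^ μ → ν₂ (A l (l + k * 2 ^ μ + j)) ≡ l + ν₂ (rising (k * 2 ^ μ) (2 * l))
  ν₂-A-block k j j<2^μ = begin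
    ν₂ (A l (l + k * 2 ^ μ + j))                  ≡⟨ cong (ν₂ ∘ A l) (+-assoc l _ j) ⟩
    ν₂ (A l (l + (k * 2 ^ μ + j)))                ≡⟨ ν₂-A l _ ⟩
    l + ν₂ (rising (k * 2 ^ μ + j) (2 * l))       ≡⟨ cong (l +_) (ν₂-rising-block (2 * l) μ 2^μ∣2l k j j<2^μ) ⟩
    l + ν₂ (rising (k * 2 ^ μ) (2 * l))           ∎
    where
    open ≡-Reasoning
    2^μ∣2l = subst (λ e → 2 ^ e ∣ 2 * l) ν₂[2l]≡μ (2^ν₂∣ (2 * l))
  constantOnBlocks : ∀ k j j′ → j < 2 ^ μ → j′ < 2 ^ μ → ν₂ (A l (l + k * 2 ^ μ + j)) ≡ ν₂ (A l (l + k * 2 ^ μ + j′))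
  constantOnBlocks k j j′ j<2^μ j′<2^μ = trans (ν₂-A-block k j j<2^μ) (sym (ν₂-A-block k j′ j′<2^μ))
  changesBetweenBlocks : ∀ k → ν₂ (A l (l + suc k * 2 ^ μ)) ≢ ν₂ (A l (l + k * 2 ^ μ))
  changesBetweenBlocks k eq = subst (λ e → ν₂ (rising (suc k * 2 ^ e) (2 * l)) ≢ ν₂ (rising (k * 2 ^ e) (2 * l)))
    ν₂[2l]≡μ (ν₂-rising-jump (2 * l) k) (+-cancelˡ-≡ l _ _ (trans (sym (ν₂-A l _)) (trans eq (ν₂-A l _))))
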